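{- Let $D$ be a finite directed graph that is essentially a tree. Then $\Delta(D)$ is vertex decomposable, and hence shellable.
   Context: A directed graph $D$ is essentially a tree if it becomes an undirected tree when every directed edge, or pair of oppositely directed edges between the same two vertices, is replaced by a single undirected edge. $\Delta(D)$ is the simplicial complex whose vertices are the directed edges of $D$ and whose faces are the edge sets of directed forests (families of vertex-disjoint rooted directed trees) contained in $D$; it need not be pure. A simplicial complex $\Delta$ is vertex decomposable if it is a simplex or it has a shedding vertex $v$ such that the deletion $\Delta\setminus\{v\}$ and the link $\mathrm{link}_\Delta v$ are vertex decomposable (and no facet of the link is a facet of the deletion). Shellability is in the (possibly nonpure) sense: there is a linear order $F_1,\dots,F_t$ of the facets such that for all $i<j$ there exist $l<j$ and a vertex $v\in F_j$ with $F_i\cap F_j\subseteq F_l\cap F_j=F_j\setminus\{v\}$. -}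

module Defs where

open import Data.Nat using (ℕ; _*_; _≤_; _<_)
open import Data.Bool using (Bool; true; false)
open import Data.Fin using (Fin; combine)
open import Data.Fin.Subset using (Subset; _∈_; _∉_; _⊆_; ⁅_⁆; _∪_; _∩_; _-_)
open import Data.List using (List; _∷_; []; length; _++_)
open import Data.List.Relation.Unary.Unique.Propositional using (Unique)
open import Data.List.Relation.Unary.Linked using (Linked)
open import Data.Product using (Σ; ∃; _×_; _,_)
open import Data.Sum using (_⊎_)
open import Data.Empty using (⊥)
open import Relation.Nullary using (¬_)
open import Relation.Binary.PropositionalEquality using (_≡_; _≢_)
open import Relation.Binary.Construct.Closure.Transitive using (TransClosure)
open import Relation.Binary.Construct.Closure.ReflexiveTransitive using (Star)
open import Level using (suc; zero)

-- Abstract simplicial complexes on the ground set Fin m.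
-- A complex is given by its family of faces (a predicate on subsets).
-- Its vertices are the ground elements v with ⁅ v ⁆ a face.

Complex : ℕ → Set₁
Complex m = Subset m → Set

IsSimplicialComplex : ∀ {m} → Complex m → Set
IsSimplicialComplex {m} Δ = ∀ (F G : Subset m) → Δ F → G ⊆ F → Δ G

IsFacet : ∀ {m} → Complex m → Subset m → Set
IsFacet {m} Δ F = Δ F × (∀ (G : Subset m) → Δ G → F ⊆ G → G ≡ F)

IsSimplex : ∀ {m} → Complex m → Set
IsSimplex {m} Δ = Σ (Subset m) λ σ → (∀ (F : Subset m) → Δ F → F ⊆ σ) × (∀ (F : Subset m) → F ⊆ σ → Δ F)

deletion : ∀ {m} → Complex m → Fin m → Complex m
deletion Δ v F = Δ F × v ∉ F

link : ∀ {m} → Complex m → Fin m → Complex m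
link Δ v F = Δ (F ∪ ⁅ v ⁆) × v ∉ F

IsShedding : ∀ {m} → Complex m → Fin m → Set
IsShedding {m} Δ v = ∀ (F : Subset m) → IsFacet (link Δ v) F → ¬ IsFacet (deletion Δ v) F

data VertexDecomposable {m : ℕ} : Complex m → Set₁ where
  simplexVD : ∀ {Δ} → IsSimplex Δ → VertexDecomposable Δ
  sheddingVD : ∀ {Δ} (v : Fin m) → Δ ⁅ v ⁆ → IsShedding Δ v
             → VertexDecomposable (deletion Δ v)
             → VertexDecomposable (link Δ v)
             → VertexDecomposable Δ

-- (nonpure) shellability: a linear order F₀,…,F_{t-1} listing every facet
-- exactly once, such that for i < j there are l < j and v ∈ F_j with
-- F_i ∩ F_j ⊆ F_l ∩ F_j = F_j ∖ {v}.
IsShelling : ∀ {m} → Complex m → (t : ℕ) → (Fin t → Subset m) → Set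
IsShelling {m} Δ t F =
  (∀ i → IsFacet Δ (F i)) ×
  (∀ (G : Subset m) → IsFacet Δ G → Σ (Fin t) λ i → F i ≡ G) ×
  (∀ i j → F i ≡ F j → i ≡ j) ×
  (∀ (i j : Fin t) → Data.Fin._<_ i j →
     Σ (Fin t) λ l → Σ (Fin m) λ v →
       Data.Fin._<_ l j × v ∈ F j ×
       (F i ∩ F j ⊆ F l ∩ F j) × (F l ∩ F j ≡ F j - v))

Shellable : ∀ {m} → Complex m → Set
Shellable Δ = Σ ℕ λ t → Σ (Fin t → Subset _) λ F → IsShelling Δ t F

-- Finite directed graphs on the vertex set Fin n (no multiple edges;
-- both directions i→j and j→i may be present).

record Digraph (n : ℕ) : Set where
  field
    adj : Fin n → Fin n → Bool   -- adj i j ≡ true  iff  i → j is an edge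

open Digraph public

Arc : ∀ {n} → Digraph n → Fin n → Fin n → Set
Arc D i j = adj D i j ≡ true

UAdj : ∀ {n} → Digraph n → Fin n → Fin n → Set
UAdj D i j = Arc D i j ⊎ Arc D j i

UCycle : ∀ {n} → Digraph n → List (Fin n) → Set
UCycle D [] = ⊥
UCycle D (x ∷ xs) = (3 ≤ length (x ∷ xs)) × Unique (x ∷ xs) × Linked (UAdj D) ((x ∷ xs) ++ (x ∷ []))

EssentiallyTree : ∀ {n} → Digraph n → Set
EssentiallyTree {n} D =
  (∀ (i : Fin n) → ¬ Arc D i i) ×
  (∀ (i j : Fin n) → Star (UAdj D) i j) ×
  (∀ (c : List (Fin n)) → ¬ UCycle D c)

-- Ground set: ordered pairs (i , j) of vertices,
-- encoded as combine i j : Fin (n * n); the vertices of Δ(D) are the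
-- arcs of D.  A set F of arcs is a directed forest (vertex-disjoint
-- union of rooted trees, arcs directed away from the roots) iff every
-- vertex has in-degree ≤ 1 in F and F has no directed cycle.

InF : ∀ {n} → Subset (n * n) → Fin n → Fin n → Set
InF F i j = combine i j ∈ F

IsDirectedForestIn : ∀ {n} → Digraph n → Subset (n * n) → Set
IsDirectedForestIn {n} D F =
  (∀ (i j : Fin n) → InF F i j → Arc D i j) ×
  (∀ (i i' j : Fin n) → InF F i j → InF F i' j → i ≡ i') ×
  (∀ (v : Fin n) → ¬ TransClosure (InF F) v v)

ΔD : ∀ {n} → Digraph n → Complex (n * n)
ΔD D F = IsDirectedForestIn D F

module Submission where

-- The proof has three independent ingredients.
-- (1) Björner–Wachs: a vertex decomposable simplicial complex is shellable.  At a
--     shedding vertex v the facets of Δ are the facets of the deletion together with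
--     the cones G ∪ {v} over facets G of the link; a shelling of the deletion followed
--     by the coned shelling of the link is a shelling of Δ (`vd⇒shellable`).
-- (2) Woodroofe: in the independence complex Ind A of a graph on the vertex set A, if
--     N[u] ⊆ N[v] for adjacent u, v, then v is a shedding vertex, with deletion Ind (A - v)
--     and link Ind (A minus N[v]).  Hence if every edge-carrying vertex set has such a
--     dominated pair, every Ind A is vertex decomposable (`dominance⇒vd`).
-- (3) For D essentially a tree, Δ(D) is the independence complex of the conflict graph
--     on the arcs (same head, or opposite arcs), since directed cycles in a tree are
--     2-cycles (`forests≅independent`); and every conflicting set of arcs has a dominated
--     pair, for otherwise one could walk forever in the tree without backtracking
--     (`dominated-pair`, `no-endless-walk`).

open import Data.Nat using (ℕ; zero; suc; _+_; _*_; _<_; s≤s; z≤n)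
import Data.Nat.Properties as ℕₚ
open import Data.Bool using (true)
open import Data.Bool.Properties using () renaming (_≟_ to _≟ᵇ_)
open import Data.Fin as Fin using (Fin; zero; suc; _↑ˡ_; _↑ʳ_; splitAt; toℕ; combine; remQuot)
open import Data.Fin.Properties
  using (_≟_; any?; all?; ¬∀⟶∃¬; toℕ-↑ˡ; toℕ-↑ʳ; toℕ<n; splitAt⁻¹-↑ˡ; splitAt⁻¹-↑ʳ;
         remQuot-combine; combine-remQuot)
open import Data.Fin.Subset as Subset
  using (Subset; _∈_; _∉_; _⊆_; _⊂_; _⊃_; ⁅_⁆; _∪_; _∩_; _-_; _─_; inside; outside)
open import Data.Fin.Subset.Properties
  using (_∈?_; x∈p∪q⁻; x∈p∪q⁺; p⊆p∪q; q⊆p∪q; x∈p∩q⁺; x∈p∩q⁻; x∈⁅x⁆; x∈⁅y⁆⇒x≡y; ∉⊥;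
         ⊆-refl; ⊆-reflexive; ⊆-trans; ⊆-antisym; p─q⊆p; x∈p∧x≢y⇒x∈p-y; x∈p⇒p-x⊂p;
         ∪-distribʳ-∩)
open import Data.Fin.Subset.Induction using (⊂-wellFounded; ⊃-wellFounded)
open import Induction.WellFounded using (Acc; acc)
open import Data.Vec using (_∷_; here; there; tabulate)
open import Data.Vec.Properties using (lookup∘tabulate; []=⇒lookup; lookup⇒[]=)
open import Data.Vec.Functional using () renaming (_++_ to _++ᵛ_)
open import Data.Vec.Functional.Properties using (lookup-++ˡ; lookup-++ʳ)
open import Data.List using (List; []; _∷_; _++_)
import Data.List.Membership.Propositional as List
open import Data.List.Membership.Propositional.Properties using (∈-∃++)
open import Data.List.Relation.Unary.Any using (here; there)
open import Data.List.Relation.Unary.All as All using (All; []; _∷_)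
import Data.List.Relation.Unary.All.Properties as Allₚ
open import Data.List.Relation.Unary.AllPairs using ([]; _∷_)
open import Data.List.Relation.Unary.Unique.Propositional using (Unique)
open import Data.List.Relation.Unary.Linked using (Linked; []; [-]; _∷_)
open import Data.Product using (Σ; _×_; _,_; proj₁; proj₂)
open import Data.Sum using (_⊎_; inj₁; inj₂; [_,_]′; map₂; swap)
open import Data.Empty using (⊥; ⊥-elim)
open import Function using (id)
open import Relation.Nullary using (¬_; Dec; yes; no; does)
open import Relation.Nullary.Decidable using (_×-dec_; _⊎-dec_; _→-dec_; ¬?; decidable-stable)
open import Relation.Binary.PropositionalEquality
open import Relation.Binary.Construct.Closure.Transitive using (TransClosure; [_]; _∷_; _∷ʳ_)
open import Defs

x∈p─q⇒x∉q : ∀ {m} (p q : Subset m) {x} → x ∈ p ─ q → x ∉ q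
x∈p─q⇒x∉q (_ ∷ p) (inside  ∷ q) {zero}  ()
x∈p─q⇒x∉q (_ ∷ p) (outside ∷ q) {zero}  _ ()
x∈p─q⇒x∉q (_ ∷ p) (_       ∷ q) {suc x} (there x∈) (there x∈q) = x∈p─q⇒x∉q p q x∈ x∈q

∈-⁻ : ∀ {m} {p : Subset m} {x y} → x ∈ p - y → x ∈ p × x ≢ y
∈-⁻ {p = p} {y = y} x∈ =
  p─q⊆p p ⁅ y ⁆ x∈ , λ { refl → x∈p─q⇒x∉q p ⁅ y ⁆ x∈ (x∈⁅x⁆ y) }

∉-p-v : ∀ {m} {p : Subset m} {v} → v ∉ p - v
∉-p-v v∈ = proj₂ (∈-⁻ v∈) refl

∈⇒≢ : ∀ {m} {p : Subset m} {x v} → v ∉ p → x ∈ p → x ≢ v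
∈⇒≢ v∉p x∈p refl = v∉p x∈p

∪⁅⁆⁻ : ∀ {m} {p : Subset m} {v x} → x ∈ p ∪ ⁅ v ⁆ → x ∈ p ⊎ x ≡ v
∪⁅⁆⁻ {p = p} {v} x∈ = map₂ (x∈⁅y⁆⇒x≡y v) (x∈p∪q⁻ p ⁅ v ⁆ x∈)

v∈p∪⁅v⁆ : ∀ {m} {p : Subset m} {v} → v ∈ p ∪ ⁅ v ⁆
v∈p∪⁅v⁆ {p = p} {v} = q⊆p∪q p ⁅ v ⁆ (x∈⁅x⁆ v)

∪⁅⁆-monoˡ : ∀ {m} {p q : Subset m} {v} → p ⊆ q → p ∪ ⁅ v ⁆ ⊆ q ∪ ⁅ v ⁆
∪⁅⁆-monoˡ p⊆q x∈ = [ (λ x∈p → p⊆p∪q _ (p⊆q x∈p)) , (λ { refl → v∈p∪⁅v⁆ }) ]′ (∪⁅⁆⁻ x∈)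

minus-plus : ∀ {m} {G : Subset m} {v} → v ∈ G → (G - v) ∪ ⁅ v ⁆ ≡ G
minus-plus {G = G} {v} v∈G = ⊆-antisym
  (λ x∈ → [ (λ x∈G-v → proj₁ (∈-⁻ x∈G-v)) , (λ { refl → v∈G }) ]′ (∪⁅⁆⁻ x∈))
  (λ {x} x∈G → restore x x∈G)
  where
  restore : ∀ x → x ∈ G → x ∈ (G - v) ∪ ⁅ v ⁆
  restore x x∈G with x ≟ v
  ... | yes refl = v∈p∪⁅v⁆
  ... | no  x≢v  = p⊆p∪q _ (x∈p∧x≢y⇒x∈p-y x∈G x≢v)

plus-minus : ∀ {m} {F : Subset m} {v} → v ∉ F → (F ∪ ⁅ v ⁆) - v ≡ F
plus-minus v∉F = ⊆-antisym
  (λ x∈ → let (x∈F∪v , x≢v) = ∈-⁻ x∈ in [ id , (λ x≡v → ⊥-elim (x≢v x≡v)) ]′ (∪⁅⁆⁻ x∈F∪v))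
  (λ x∈F → x∈p∧x≢y⇒x∈p-y (p⊆p∪q _ x∈F) (∈⇒≢ v∉F x∈F))

minus-plus-comm : ∀ {m} {Y : Subset m} {v w} → w ≢ v → (Y - w) ∪ ⁅ v ⁆ ≡ (Y ∪ ⁅ v ⁆) - w
minus-plus-comm w≢v = ⊆-antisym
  (λ x∈ → [ (λ x∈Y-w → let (x∈Y , x≢w) = ∈-⁻ x∈Y-w in x∈p∧x≢y⇒x∈p-y (p⊆p∪q _ x∈Y) x≢w)
          , (λ { refl → x∈p∧x≢y⇒x∈p-y v∈p∪⁅v⁆ (λ v≡w → w≢v (sym v≡w)) }) ]′ (∪⁅⁆⁻ x∈))
  (λ x∈ → let (x∈Y∪v , x≢w) = ∈-⁻ x∈ in
     [ (λ x∈Y → p⊆p∪q _ (x∈p∧x≢y⇒x∈p-y x∈Y x≢w)) , (λ { refl → v∈p∪⁅v⁆ }) ]′ (∪⁅⁆⁻ x∈Y∪v))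

subsetOf : ∀ {m} {P : Fin m → Set} → (∀ x → Dec (P x)) → Subset m
subsetOf P? = tabulate (λ x → does (P? x))

∈subsetOf⁺ : ∀ {m} {P : Fin m → Set} (P? : ∀ x → Dec (P x)) {x} → P x → x ∈ subsetOf P?
∈subsetOf⁺ {P = P} P? {x} px = lookup⇒[]= x _ (trans (lookup∘tabulate _ x) (holds (P? x)))
  where
  holds : (d : Dec (P x)) → does d ≡ true
  holds (yes _) = refl
  holds (no ¬px) = ⊥-elim (¬px px)

∈subsetOf⁻ : ∀ {m} {P : Fin m → Set} (P? : ∀ x → Dec (P x)) {x} → x ∈ subsetOf P? → P x
∈subsetOf⁻ {P = P} P? {x} x∈ = witness (P? x) (trans (sym (lookup∘tabulate _ x)) ([]=⇒lookup x∈))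
  where
  witness : (d : Dec (P x)) → does d ≡ true → P x
  witness (yes px) _ = px

SameFaces : ∀ {m} → Complex m → Complex m → Set
SameFaces {m} Δ Δ' = (∀ (F : Subset m) → Δ F → Δ' F) × (∀ (F : Subset m) → Δ' F → Δ F)

SameFaces-sym : ∀ {m} {Δ Δ' : Complex m} → SameFaces Δ Δ' → SameFaces Δ' Δ
SameFaces-sym (to , from) = from , to

sc-cong : ∀ {m} {Δ Δ' : Complex m} → SameFaces Δ Δ' → IsSimplicialComplex Δ → IsSimplicialComplex Δ'
sc-cong (to , from) sc F G F∈ G⊆F = to G (sc F G (from F F∈) G⊆F)

facet-cong : ∀ {m} {Δ Δ' : Complex m} → SameFaces Δ Δ' → ∀ {F} → IsFacet Δ F → IsFacet Δ' F
facet-cong (to , from) (F∈ , max) = to _ F∈ , λ G G∈ F⊆G → max G (from G G∈) F⊆G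

deletion-cong : ∀ {m} {Δ Δ' : Complex m} (v : Fin m) → SameFaces Δ Δ' → SameFaces (deletion Δ v) (deletion Δ' v)
deletion-cong v (to , from) = (λ F (F∈ , v∉F) → to F F∈ , v∉F) , (λ F (F∈ , v∉F) → from F F∈ , v∉F)

link-cong : ∀ {m} {Δ Δ' : Complex m} (v : Fin m) → SameFaces Δ Δ' → SameFaces (link Δ v) (link Δ' v)
link-cong v (to , from) = (λ F (F∈ , v∉F) → to _ F∈ , v∉F) , (λ F (F∈ , v∉F) → from _ F∈ , v∉F)

vd-cong : ∀ {m} {Δ Δ' : Complex m} → SameFaces Δ Δ' → VertexDecomposable Δ → VertexDecomposable Δ'
vd-cong (to , from) (simplexVD (σ , inσ , ofσ)) =
  simplexVD (σ , (λ F F∈ → inσ F (from F F∈)) , (λ F F⊆σ → to F (ofσ F F⊆σ)))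
vd-cong same (sheddingVD v v∈ shed vdD vdL) =
  sheddingVD v (proj₁ same _ v∈)
    (λ F linkF delF → shed F (facet-cong (SameFaces-sym (link-cong v same)) linkF)
                             (facet-cong (SameFaces-sym (deletion-cong v same)) delF))
    (vd-cong (deletion-cong v same) vdD) (vd-cong (link-cong v same) vdL)

deletion-sc : ∀ {m} {Δ : Complex m} (v : Fin m) → IsSimplicialComplex Δ → IsSimplicialComplex (deletion Δ v)
deletion-sc v sc F G (F∈ , v∉F) G⊆F = sc F G F∈ G⊆F , λ v∈G → v∉F (G⊆F v∈G)

link-sc : ∀ {m} {Δ : Complex m} (v : Fin m) → IsSimplicialComplex Δ → IsSimplicialComplex (link Δ v)
link-sc v sc F G (F∈ , v∉F) G⊆F = sc _ _ F∈ (∪⁅⁆-monoˡ G⊆F) , λ v∈G → v∉F (G⊆F v∈G)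

module _ {m} {Δ : Complex m} (v : Fin m) where

  cone-facet : ∀ {G} → IsFacet (link Δ v) G → IsFacet Δ (G ∪ ⁅ v ⁆)
  cone-facet {G} ((G∪v∈ , v∉G) , max) = G∪v∈ , grow
    where
    grow : ∀ H → Δ H → G ∪ ⁅ v ⁆ ⊆ H → H ≡ G ∪ ⁅ v ⁆
    grow H H∈ G∪v⊆H = begin
      H                    ≡⟨ minus-plus v∈H ⟨
      (H - v) ∪ ⁅ v ⁆      ≡⟨ cong (_∪ ⁅ v ⁆) H-v≡G ⟩
      G ∪ ⁅ v ⁆            ∎
      where
      open ≡-Reasoning
      v∈H : v ∈ H
      v∈H = G∪v⊆H v∈p∪⁅v⁆
      H-v≡G : H - v ≡ G
      H-v≡G = max (H - v) (subst Δ (sym (minus-plus v∈H)) H∈ , ∉-p-v)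
                (λ x∈G → x∈p∧x≢y⇒x∈p-y (G∪v⊆H (p⊆p∪q _ x∈G)) (∈⇒≢ v∉G x∈G))

  facet-deletion : ∀ {F} → v ∉ F → IsFacet Δ F → IsFacet (deletion Δ v) F
  facet-deletion v∉F (F∈ , max) = (F∈ , v∉F) , λ G (G∈ , _) → max G G∈

  facet-link : ∀ {F} → v ∈ F → IsFacet Δ F → IsFacet (link Δ v) (F - v)
  facet-link {F} v∈F (F∈ , max) = (subst Δ (sym (minus-plus v∈F)) F∈ , ∉-p-v) , shrink
    where
    shrink : ∀ G → link Δ v G → F - v ⊆ G → G ≡ F - v
    shrink G (G∪v∈ , v∉G) F-v⊆G = begin
      G                    ≡⟨ plus-minus v∉G ⟨
      (G ∪ ⁅ v ⁆) - v      ≡⟨ cong (_- v) (max (G ∪ ⁅ v ⁆) G∪v∈ F⊆G∪v) ⟩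
      F - v                ∎
      where
      open ≡-Reasoning
      F⊆G∪v : F ⊆ G ∪ ⁅ v ⁆
      F⊆G∪v = ⊆-trans (⊆-reflexive (sym (minus-plus v∈F))) (∪⁅⁆-monoˡ F-v⊆G)

  -- for a shedding vertex every facet of the deletion is a facet of Δ: otherwise
  -- it would also be a facet of the link
  deletion-facet : IsSimplicialComplex Δ → IsShedding Δ v → ∀ {F} → IsFacet (deletion Δ v) F → IsFacet Δ F
  deletion-facet sc shed {F} delF@((F∈ , v∉F) , max) = F∈ , grow
    where
    grow : ∀ H → Δ H → F ⊆ H → H ≡ F
    grow H H∈ F⊆H with v ∈? H
    ... | no  v∉H = max H (H∈ , v∉H) F⊆H
    ... | yes v∈H = ⊥-elim (shed F linkF delF)
      where
      F∪v⊆H : F ∪ ⁅ v ⁆ ⊆ H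
      F∪v⊆H x∈ = [ F⊆H , (λ { refl → v∈H }) ]′ (∪⁅⁆⁻ x∈)
      linkF : IsFacet (link Δ v) F
      linkF = (sc H _ H∈ F∪v⊆H , v∉F) ,
              λ G (G∪v∈ , v∉G) F⊆G → max G (sc _ G G∪v∈ (p⊆p∪q _) , v∉G) F⊆G

-- Every face lies in a facet (needed to place a link facet below a deletion facet).
HasEnoughFacets : ∀ {m} → Complex m → Set
HasEnoughFacets {m} Δ = ∀ (F : Subset m) → Δ F → Σ (Subset m) λ G → F ⊆ G × IsFacet Δ G

-- In a vertex decomposable simplicial complex every face lies in a facet: recurse into
-- the deletion or the link according to whether the face contains the shedding vertex.
vd-enoughFacets : ∀ {m} {Δ : Complex m} → IsSimplicialComplex Δ → VertexDecomposable Δ → HasEnoughFacets Δ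
vd-enoughFacets sc (simplexVD (σ , inσ , ofσ)) F F∈ =
  σ , inσ F F∈ , ofσ σ ⊆-refl , λ G G∈ σ⊆G → ⊆-antisym (inσ G G∈) σ⊆G
vd-enoughFacets {Δ = Δ} sc (sheddingVD v _ shed vdD vdL) F F∈ with v ∈? F
... | no v∉F =
  let (G , F⊆G , facetG) = vd-enoughFacets (deletion-sc v sc) vdD F (F∈ , v∉F)
  in G , F⊆G , deletion-facet v sc shed facetG
... | yes v∈F =
  let (G , F-v⊆G , facetG) = vd-enoughFacets (link-sc v sc) vdL (F - v)
                               (subst Δ (sym (minus-plus v∈F)) F∈ , ∉-p-v)
  in G ∪ ⁅ v ⁆ , ⊆-trans (⊆-reflexive (sym (minus-plus v∈F))) (∪⁅⁆-monoˡ F-v⊆G) , cone-facet v facetG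

Exchange : ∀ {m} → Subset m → Subset m → Subset m → Fin m → Set
Exchange X Y Z w = w ∈ Y × (X ∩ Y ⊆ Z ∩ Y) × (Z ∩ Y ≡ Y - w)

ShellingOrder : ∀ {m} (t : ℕ) → (Fin t → Subset m) → Set
ShellingOrder {m} t F = ∀ (i j : Fin t) → i Fin.< j →
  Σ (Fin t) λ l → Σ (Fin m) λ w → l Fin.< j × Exchange (F i) (F j) (F l) w

Exchange-cong : ∀ {m} {X X' Y Y' Z Z' : Subset m} {w} → X ≡ X' → Y ≡ Y' → Z ≡ Z'
              → Exchange X Y Z w → Exchange X' Y' Z' w
Exchange-cong refl refl refl ex = ex

cone-exchange : ∀ {m} {X Y Z : Subset m} {v w} → v ∉ Y → Exchange X Y Z w
              → Exchange (X ∪ ⁅ v ⁆) (Y ∪ ⁅ v ⁆) (Z ∪ ⁅ v ⁆) w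
cone-exchange {X = X} {Y} {Z} {v} {w} v∉Y (w∈Y , X∩Y⊆ , Z∩Y≡) = p⊆p∪q _ w∈Y , inc , eq
  where
  open ≡-Reasoning
  inc : (X ∪ ⁅ v ⁆) ∩ (Y ∪ ⁅ v ⁆) ⊆ (Z ∪ ⁅ v ⁆) ∩ (Y ∪ ⁅ v ⁆)
  inc = subst₂ _⊆_ (∪-distribʳ-∩ ⁅ v ⁆ X Y) (∪-distribʳ-∩ ⁅ v ⁆ Z Y) (∪⁅⁆-monoˡ X∩Y⊆)
  eq : (Z ∪ ⁅ v ⁆) ∩ (Y ∪ ⁅ v ⁆) ≡ (Y ∪ ⁅ v ⁆) - w
  eq = begin
    (Z ∪ ⁅ v ⁆) ∩ (Y ∪ ⁅ v ⁆)  ≡⟨ ∪-distribʳ-∩ ⁅ v ⁆ Z Y ⟨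
    (Z ∩ Y) ∪ ⁅ v ⁆            ≡⟨ cong (_∪ ⁅ v ⁆) Z∩Y≡ ⟩
    (Y - w) ∪ ⁅ v ⁆            ≡⟨ minus-plus-comm (∈⇒≢ v∉Y w∈Y) ⟩
    (Y ∪ ⁅ v ⁆) - w            ∎

-- A cone Y ∪ {v} over a base Y ⊆ Z: every X avoiding v meets it inside Z, and Z
-- meets it in exactly Y = (Y ∪ {v}) ∖ {v}.
apex-exchange : ∀ {m} {X Y Z : Subset m} {v} → v ∉ X → v ∉ Z → v ∉ Y → Y ⊆ Z
              → Exchange X (Y ∪ ⁅ v ⁆) Z v
apex-exchange {X = X} {Y} {Z} {v} v∉X v∉Z v∉Y Y⊆Z = v∈p∪⁅v⁆ , inc , eq
  where
  base : ∀ {W x} → v ∉ W → x ∈ W → x ∈ Y ∪ ⁅ v ⁆ → x ∈ Y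
  base v∉W x∈W x∈ = [ id , (λ x≡v → ⊥-elim (∈⇒≢ v∉W x∈W x≡v)) ]′ (∪⁅⁆⁻ x∈)
  inc : X ∩ (Y ∪ ⁅ v ⁆) ⊆ Z ∩ (Y ∪ ⁅ v ⁆)
  inc x∈ = let (x∈X , x∈Y∪v) = x∈p∩q⁻ _ _ x∈ in x∈p∩q⁺ (Y⊆Z (base v∉X x∈X x∈Y∪v) , x∈Y∪v)
  eq : Z ∩ (Y ∪ ⁅ v ⁆) ≡ (Y ∪ ⁅ v ⁆) - v
  eq = trans (⊆-antisym (λ x∈ → let (x∈Z , x∈Y∪v) = x∈p∩q⁻ _ _ x∈ in base v∉Z x∈Z x∈Y∪v)
                        (λ x∈Y → x∈p∩q⁺ (Y⊆Z x∈Y , p⊆p∪q _ x∈Y)))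
             (sym (plus-minus v∉Y))

cone : ∀ {m t} → Fin m → (Fin t → Subset m) → Fin t → Subset m
cone v Q j = Q j ∪ ⁅ v ⁆

cone-shellingOrder : ∀ {m t} {Q : Fin t → Subset m} (v : Fin m) → (∀ j → v ∉ Q j)
                   → ShellingOrder t Q → ShellingOrder t (cone v Q)
cone-shellingOrder v v∉Q order i j i<j =
  let (l , w , l<j , ex) = order i j i<j in l , w , l<j , cone-exchange (v∉Q j) ex

data Split (t₁ t₂ : ℕ) : Fin (t₁ + t₂) → Set where
  left  : (i : Fin t₁) → Split t₁ t₂ (i ↑ˡ t₂)
  right : (j : Fin t₂) → Split t₁ t₂ (t₁ ↑ʳ j)

split : ∀ t₁ {t₂} (k : Fin (t₁ + t₂)) → Split t₁ t₂ k
split t₁ k with splitAt t₁ k in eq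
... | inj₁ i = subst (Split _ _) (splitAt⁻¹-↑ˡ eq) (left i)
... | inj₂ j = subst (Split _ _) (splitAt⁻¹-↑ʳ eq) (right j)

↑ˡ-<⁻ : ∀ {t₁} t₂ {i j : Fin t₁} → (i ↑ˡ t₂) Fin.< (j ↑ˡ t₂) → i Fin.< j
↑ˡ-<⁻ t₂ {i} {j} = subst₂ _<_ (toℕ-↑ˡ i t₂) (toℕ-↑ˡ j t₂)

↑ˡ-<⁺ : ∀ {t₁} t₂ {i j : Fin t₁} → i Fin.< j → (i ↑ˡ t₂) Fin.< (j ↑ˡ t₂)
↑ˡ-<⁺ t₂ {i} {j} = subst₂ _<_ (sym (toℕ-↑ˡ i t₂)) (sym (toℕ-↑ˡ j t₂))

↑ʳ-<⁻ : ∀ t₁ {t₂} {i j : Fin t₂} → (t₁ ↑ʳ i) Fin.< (t₁ ↑ʳ j) → i Fin.< j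
↑ʳ-<⁻ t₁ {i = i} {j} lt = ℕₚ.+-cancelˡ-< t₁ (toℕ i) (toℕ j) (subst₂ _<_ (toℕ-↑ʳ t₁ i) (toℕ-↑ʳ t₁ j) lt)

↑ʳ-<⁺ : ∀ t₁ {t₂} {i j : Fin t₂} → i Fin.< j → (t₁ ↑ʳ i) Fin.< (t₁ ↑ʳ j)
↑ʳ-<⁺ t₁ {i = i} {j} lt = subst₂ _<_ (sym (toℕ-↑ʳ t₁ i)) (sym (toℕ-↑ʳ t₁ j)) (ℕₚ.+-monoʳ-< t₁ lt)

↑ˡ<↑ʳ : ∀ {t₁ t₂} (i : Fin t₁) (j : Fin t₂) → (i ↑ˡ t₂) Fin.< (t₁ ↑ʳ j)
↑ˡ<↑ʳ {t₁} {t₂} i j = subst₂ _<_ (sym (toℕ-↑ˡ i t₂)) (sym (toℕ-↑ʳ t₁ j))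
                        (ℕₚ.<-≤-trans (toℕ<n i) (ℕₚ.m≤m+n t₁ (toℕ j)))

↑ʳ≮↑ˡ : ∀ {t₁ t₂} (i : Fin t₂) (j : Fin t₁) → ¬ ((t₁ ↑ʳ i) Fin.< (j ↑ˡ t₂))
↑ʳ≮↑ˡ i j lt = ℕₚ.<-asym (↑ˡ<↑ʳ j i) lt

module Concat {m t₁ t₂} (P : Fin t₁ → Subset m) (R : Fin t₂ → Subset m) where

  private
    atˡ : ∀ i → P i ≡ (P ++ᵛ R) (i ↑ˡ t₂)
    atˡ i = sym (lookup-++ˡ P R i)
    atʳ : ∀ j → R j ≡ (P ++ᵛ R) (t₁ ↑ʳ j)
    atʳ j = sym (lookup-++ʳ P R j)

  ++-all : (Prop : Subset m → Set) → (∀ i → Prop (P i)) → (∀ j → Prop (R j)) → ∀ k → Prop ((P ++ᵛ R) k)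
  ++-all Prop propP propR k with split t₁ k
  ... | left  i = subst Prop (atˡ i) (propP i)
  ... | right j = subst Prop (atʳ j) (propR j)

  ++-listsˡ : ∀ {G} i → P i ≡ G → Σ (Fin (t₁ + t₂)) λ k → (P ++ᵛ R) k ≡ G
  ++-listsˡ i Pi≡G = i ↑ˡ t₂ , trans (sym (atˡ i)) Pi≡G

  ++-listsʳ : ∀ {G} j → R j ≡ G → Σ (Fin (t₁ + t₂)) λ k → (P ++ᵛ R) k ≡ G
  ++-listsʳ j Rj≡G = t₁ ↑ʳ j , trans (sym (atʳ j)) Rj≡G

  ++-injective : (∀ i i' → P i ≡ P i' → i ≡ i') → (∀ j j' → R j ≡ R j' → j ≡ j')
               → (∀ i j → P i ≢ R j) → ∀ k k' → (P ++ᵛ R) k ≡ (P ++ᵛ R) k' → k ≡ k'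
  ++-injective injP injR disjoint k k' eq with split t₁ k | split t₁ k'
  ... | left  i | left  i' = cong (_↑ˡ t₂) (injP i i' (trans (atˡ i) (trans eq (sym (atˡ i')))))
  ... | right j | right j' = cong (t₁ ↑ʳ_) (injR j j' (trans (atʳ j) (trans eq (sym (atʳ j')))))
  ... | left  i | right j  = ⊥-elim (disjoint i j (trans (atˡ i) (trans eq (sym (atʳ j)))))
  ... | right j | left  i  = ⊥-elim (disjoint i j (trans (atˡ i) (trans (sym eq) (sym (atʳ j)))))

  ++-shellingOrder : ShellingOrder t₁ P → ShellingOrder t₂ R
                   → (∀ i j → Σ (Fin t₁) λ l → Σ (Fin m) λ w → Exchange (P i) (R j) (P l) w)
                   → ShellingOrder (t₁ + t₂) (P ++ᵛ R)
  ++-shellingOrder orderP orderR across k k' k<k' with split t₁ k | split t₁ k'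
  ... | left i | left j =
    let (l , w , l<j , ex) = orderP i j (↑ˡ-<⁻ t₂ k<k')
    in l ↑ˡ t₂ , w , ↑ˡ-<⁺ t₂ l<j , Exchange-cong (atˡ i) (atˡ j) (atˡ l) ex
  ... | right i | right j =
    let (l , w , l<j , ex) = orderR i j (↑ʳ-<⁻ t₁ k<k')
    in t₁ ↑ʳ l , w , ↑ʳ-<⁺ t₁ l<j , Exchange-cong (atʳ i) (atʳ j) (atʳ l) ex
  ... | left i | right j =
    let (l , w , ex) = across i j
    in l ↑ˡ t₂ , w , ↑ˡ<↑ʳ l j , Exchange-cong (atˡ i) (atʳ j) (atˡ l) ex
  ... | right i | left j = ⊥-elim (↑ʳ≮↑ˡ i j k<k')

simplex-shellable : ∀ {m} {Δ : Complex m} → IsSimplex Δ → Shellable Δ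
simplex-shellable {Δ = Δ} (σ , inσ , ofσ) =
  1 , (λ _ → σ) , (λ _ → σ-facet) , (λ G (G∈ , max) → zero , max σ (ofσ σ ⊆-refl) (inσ G G∈)) ,
  (λ { zero zero _ → refl }) , (λ { zero zero () })
  where
  σ-facet : IsFacet Δ σ
  σ-facet = ofσ σ ⊆-refl , λ G G∈ σ⊆G → ⊆-antisym (inσ G G∈) σ⊆G

-- The facets of Δ are
-- exactly the P i and the Q j ∪ {v}; a cone is preceded by a P-facet containing its base.
join-shellings : ∀ {m} {Δ : Complex m} (v : Fin m) → IsSimplicialComplex Δ → IsShedding Δ v
               → HasEnoughFacets (deletion Δ v)
               → ∀ {t₁ t₂ P Q} → IsShelling (deletion Δ v) t₁ P → IsShelling (link Δ v) t₂ Q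
               → IsShelling Δ (t₁ + t₂) (P ++ᵛ cone v Q)
join-shellings {m} {Δ} v sc shed enough {t₁} {t₂} {P} {Q}
               (facetP , listedP , injP , orderP) (facetQ , listedQ , injQ , orderQ) =
  ++-all (IsFacet Δ) (λ i → deletion-facet v sc shed (facetP i)) (λ j → cone-facet v (facetQ j)) ,
  listed , ++-injective injP cone-injective (λ i j Pi≡ → v∉P i (subst (v ∈_) (sym Pi≡) v∈p∪⁅v⁆)) ,
  ++-shellingOrder orderP (cone-shellingOrder v v∉Q orderQ) across
  where
  open Concat P (cone v Q)
  v∉P : ∀ i → v ∉ P i
  v∉P i = proj₂ (proj₁ (facetP i))
  v∉Q : ∀ j → v ∉ Q j
  v∉Q j = proj₂ (proj₁ (facetQ j))

  listed : ∀ G → IsFacet Δ G → Σ (Fin (t₁ + t₂)) λ k → (P ++ᵛ cone v Q) k ≡ G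
  listed G facetG with v ∈? G
  ... | no  v∉G = let (i , Pi≡G) = listedP G (facet-deletion v v∉G facetG) in ++-listsˡ i Pi≡G
  ... | yes v∈G = let (j , Qj≡G-v) = listedQ (G - v) (facet-link v v∈G facetG)
                  in ++-listsʳ j (trans (cong (_∪ ⁅ v ⁆) Qj≡G-v) (minus-plus v∈G))

  cone-injective : ∀ j j' → cone v Q j ≡ cone v Q j' → j ≡ j'
  cone-injective j j' eq =
    injQ j j' (trans (sym (plus-minus (v∉Q j))) (trans (cong (_- v) eq) (plus-minus (v∉Q j'))))

  -- the base Q j is a face of the deletion; the P-facet containing it is the witness
  across : ∀ i j → Σ (Fin t₁) λ l → Σ (Fin m) λ w → Exchange (P i) (cone v Q j) (P l) w
  across i j =
    let (Qj∪v∈ , _) = proj₁ (facetQ j)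
        (G , Qj⊆G , facetG) = enough (Q j) (sc _ (Q j) Qj∪v∈ (p⊆p∪q _) , v∉Q j)
        (l , Pl≡G) = listedP G facetG
    in l , v , apex-exchange (v∉P i) (v∉P l) (v∉Q j) (subst (Q j ⊆_) (sym Pl≡G) Qj⊆G)

vd⇒shellable : ∀ {m} {Δ : Complex m} → IsSimplicialComplex Δ → VertexDecomposable Δ → Shellable Δ
vd⇒shellable sc (simplexVD simplex) = simplex-shellable simplex
vd⇒shellable sc (sheddingVD v _ shed vdD vdL) =
  let (t₁ , P , shellingP) = vd⇒shellable (deletion-sc v sc) vdD
      (t₂ , Q , shellingQ) = vd⇒shellable (link-sc v sc) vdL
  in t₁ + t₂ , P ++ᵛ cone v Q ,
     join-shellings v sc shed (vd-enoughFacets (deletion-sc v sc) vdD) shellingP shellingQ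

module Independence {m} (C : Fin m → Fin m → Set) (C? : ∀ x y → Dec (C x y))
                    (C-sym : ∀ {x y} → C x y → C y x) (C-irr : ∀ {x} → ¬ C x x) where

  Ind : Subset m → Complex m
  Ind A F = F ⊆ A × (∀ {x y} → x ∈ F → y ∈ F → ¬ C x y)

  Ind-sc : ∀ A → IsSimplicialComplex (Ind A)
  Ind-sc A F G (F⊆A , indep) G⊆F = (λ x∈ → F⊆A (G⊆F x∈)) , λ x∈ y∈ → indep (G⊆F x∈) (G⊆F y∈)

  add-vertex : ∀ {A F x} → Ind A F → x ∈ A → (∀ {y} → y ∈ F → ¬ C x y) → Ind A (F ∪ ⁅ x ⁆)
  add-vertex {A} {F} {x} (F⊆A , indep) x∈A x-free =
    (λ y∈ → [ F⊆A , (λ { refl → x∈A }) ]′ (∪⁅⁆⁻ y∈)) , λ y∈ z∈ → pair (∪⁅⁆⁻ y∈) (∪⁅⁆⁻ z∈)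
    where
    pair : ∀ {y z} → y ∈ F ⊎ y ≡ x → z ∈ F ⊎ z ≡ x → ¬ C y z
    pair (inj₁ y∈F) (inj₁ z∈F) = indep y∈F z∈F
    pair (inj₁ y∈F) (inj₂ refl) c = x-free y∈F (C-sym c)
    pair (inj₂ refl) (inj₁ z∈F) = x-free z∈F
    pair (inj₂ refl) (inj₂ refl) = C-irr

  singleton-independent : ∀ {A v} → v ∈ A → Ind A ⁅ v ⁆
  singleton-independent {A} {v} v∈A =
    (λ x∈ → subst (_∈ A) (sym (x∈⁅y⁆⇒x≡y v x∈)) v∈A) ,
    λ x∈ y∈ → subst₂ (λ x y → ¬ C x y) (sym (x∈⁅y⁆⇒x≡y v x∈)) (sym (x∈⁅y⁆⇒x≡y v y∈)) C-irr

  HasEdge : Subset m → Set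
  HasEdge A = Σ (Fin m) λ x → Σ (Fin m) λ y → x ∈ A × y ∈ A × C x y

  hasEdge? : ∀ A → Dec (HasEdge A)
  hasEdge? A = any? λ x → any? λ y → x ∈? A ×-dec y ∈? A ×-dec C? x y

  edgeless-simplex : ∀ {A} → ¬ HasEdge A → IsSimplex (Ind A)
  edgeless-simplex {A} noEdge =
    A , (λ F → proj₁) , λ F F⊆A → F⊆A , λ x∈ y∈ c → noEdge (_ , _ , F⊆A x∈ , F⊆A y∈ , c)

  Covers : Subset m → Fin m → Fin m → Fin m → Set
  Covers A u v w = w ∈ A → C u w → w ≡ v ⊎ C v w

  -- v is a neighbour of u in A with N[u] ⊆ N[v]
  Dominated : Subset m → Fin m → Fin m → Set
  Dominated A u v = u ∈ A × v ∈ A × C u v × (∀ w → Covers A u v w)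

  covers? : ∀ A u v w → Dec (Covers A u v w)
  covers? A u v w = w ∈? A →-dec (C? u w →-dec (w ≟ v ⊎-dec C? v w))

  dominated? : ∀ A u v → Dec (Dominated A u v)
  dominated? A u v = u ∈? A ×-dec v ∈? A ×-dec C? u v ×-dec all? (covers? A u v)

  uncovered : ∀ {A u v w} → ¬ Covers A u v w → w ∈ A × C u w × w ≢ v × ¬ C v w
  uncovered {A} {u} {v} {w} ¬covers =
    decidable-stable (w ∈? A) (λ w∉A → ¬covers (λ w∈A → ⊥-elim (w∉A w∈A))) ,
    decidable-stable (C? u w) (λ ¬u~w → ¬covers (λ _ u~w → ⊥-elim (¬u~w u~w))) ,
    (λ w≡v → ¬covers (λ _ _ → inj₁ w≡v)) ,
    (λ v~w → ¬covers (λ _ _ → inj₂ v~w))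

  NonNeighbour : Subset m → Fin m → Fin m → Set
  NonNeighbour A v x = x ∈ A × x ≢ v × ¬ C v x

  nonNeighbour? : ∀ A v x → Dec (NonNeighbour A v x)
  nonNeighbour? A v x = x ∈? A ×-dec ¬? (x ≟ v) ×-dec ¬? (C? v x)

  nonNeighbours : Subset m → Fin m → Subset m
  nonNeighbours A v = subsetOf (nonNeighbour? A v)

  ∈nonNeighbours⁻ : ∀ {A v x} → x ∈ nonNeighbours A v → NonNeighbour A v x
  ∈nonNeighbours⁻ {A} {v} = ∈subsetOf⁻ (nonNeighbour? A v)

  nonNeighbours⊂ : ∀ {A v} → v ∈ A → nonNeighbours A v ⊂ A
  nonNeighbours⊂ v∈A =
    (λ x∈ → proj₁ (∈nonNeighbours⁻ x∈)) , _ , v∈A , λ v∈ → proj₁ (proj₂ (∈nonNeighbours⁻ v∈)) refl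

  deletion-Ind : ∀ A v → SameFaces (deletion (Ind A) v) (Ind (A - v))
  deletion-Ind A v =
    (λ F ((F⊆A , indep) , v∉F) → (λ x∈F → x∈p∧x≢y⇒x∈p-y (F⊆A x∈F) (∈⇒≢ v∉F x∈F)) , indep) ,
    (λ F (F⊆A-v , indep) → ((λ x∈F → proj₁ (∈-⁻ (F⊆A-v x∈F))) , indep) , λ v∈F → ∉-p-v (F⊆A-v v∈F))

  link-Ind : ∀ {A v} → v ∈ A → SameFaces (link (Ind A) v) (Ind (nonNeighbours A v))
  link-Ind {A} {v} v∈A =
    (λ F ((F∪v⊆A , indep) , v∉F) →
       (λ x∈F → ∈subsetOf⁺ (nonNeighbour? A v)
                  (F∪v⊆A (p⊆p∪q _ x∈F) , ∈⇒≢ v∉F x∈F , indep v∈p∪⁅v⁆ (p⊆p∪q _ x∈F))) ,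
       λ x∈ y∈ → indep (p⊆p∪q _ x∈) (p⊆p∪q _ y∈)) ,
    (λ F (F⊆N , indep) →
       add-vertex ((λ x∈F → proj₁ (∈nonNeighbours⁻ (F⊆N x∈F))) , indep) v∈A
                  (λ y∈F → proj₂ (proj₂ (∈nonNeighbours⁻ (F⊆N y∈F)))) ,
       λ v∈F → proj₁ (proj₂ (∈nonNeighbours⁻ (F⊆N v∈F))) refl)

  -- Woodroofe: if u is dominated by v then v is a shedding vertex of Ind A.  A facet F
  -- of the link is never a facet of the deletion, since F ∪ {u} is still independent.
  dominated-shedding : ∀ {A u v} → Dominated A u v → IsShedding (Ind A) v
  dominated-shedding {A} {u} {v} (u∈A , v∈A , u~v , covered) F (((F∪v⊆A , indep) , v∉F) , _) (_ , maxD) =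
    u∉F (subst (u ∈_) (maxD (F ∪ ⁅ u ⁆) (F∪u-independent , v∉F∪u) (p⊆p∪q _)) v∈p∪⁅v⁆)
    where
    F-independent : Ind A F
    F-independent = Ind-sc A _ F (F∪v⊆A , indep) (p⊆p∪q _)
    u∉F : u ∉ F
    u∉F u∈F = indep (p⊆p∪q _ u∈F) v∈p∪⁅v⁆ u~v
    u-free : ∀ {y} → y ∈ F → ¬ C u y
    u-free {y} y∈F u~y with covered y (F∪v⊆A (p⊆p∪q _ y∈F)) u~y
    ... | inj₁ y≡v = ∈⇒≢ v∉F y∈F y≡v
    ... | inj₂ v~y = indep v∈p∪⁅v⁆ (p⊆p∪q _ y∈F) v~y
    F∪u-independent : Ind A (F ∪ ⁅ u ⁆)
    F∪u-independent = add-vertex F-independent u∈A u-free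
    v∉F∪u : v ∉ F ∪ ⁅ u ⁆
    v∉F∪u v∈ = [ v∉F , (λ { refl → C-irr u~v }) ]′ (∪⁅⁆⁻ v∈)

  dominated-vd : ∀ {A u v} → Dominated A u v → VertexDecomposable (Ind (A - v))
               → VertexDecomposable (Ind (nonNeighbours A v)) → VertexDecomposable (Ind A)
  dominated-vd {A} {v = v} dom@(_ , v∈A , _) vdD vdL =
    sheddingVD v (singleton-independent v∈A) (dominated-shedding dom)
      (vd-cong (SameFaces-sym (deletion-Ind A v)) vdD) (vd-cong (SameFaces-sym (link-Ind v∈A)) vdL)

  -- If inside B every vertex set carrying an edge has a dominated pair, then Ind A is
  -- vertex decomposable for every A ⊆ B: shed the dominating vertex and recurse on the
  -- two strictly smaller vertex sets of the deletion and the link.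
  dominance⇒vd : ∀ B → (∀ A → A ⊆ B → HasEdge A → Σ (Fin m) λ u → Σ (Fin m) λ v → Dominated A u v)
               → ∀ A → A ⊆ B → VertexDecomposable (Ind A)
  dominance⇒vd B dominance A = go A (⊂-wellFounded A)
    where
    go : ∀ A → Acc _⊂_ A → A ⊆ B → VertexDecomposable (Ind A)
    go A (acc smaller) A⊆B with hasEdge? A
    ... | no  noEdge = simplexVD (edgeless-simplex noEdge)
    ... | yes edge =
      let (_ , v , dom@(_ , v∈A , _)) = dominance A A⊆B edge
      in dominated-vd dom
           (go (A - v) (smaller (x∈p⇒p-x⊂p v∈A)) (⊆-trans (p─q⊆p A ⁅ v ⁆) A⊆B))
           (go (nonNeighbours A v) (smaller (nonNeighbours⊂ v∈A))
               (⊆-trans (proj₁ (nonNeighbours⊂ v∈A)) A⊆B))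

unique-split : ∀ {A : Set} (xs : List A) {y ys} → Unique (xs ++ y ∷ ys) → Unique xs × All (_≢ y) xs
unique-split []       _            = [] , []
unique-split (x ∷ xs) (x≢ ∷ unique) =
  let (uniqueXs , ≢y) = unique-split xs unique
  in Allₚ.++⁻ˡ xs x≢ ∷ uniqueXs , All.head (Allₚ.++⁻ʳ xs x≢) ∷ ≢y

linked-prefix : ∀ {A : Set} {R : A → A → Set} (xs : List A) {y ys}
              → Linked R (xs ++ y ∷ ys) → Linked R (xs ++ y ∷ [])
linked-prefix []            _       = [-]
linked-prefix (x ∷ [])      (r ∷ _) = r ∷ [-]
linked-prefix (x ∷ x' ∷ xs) (r ∷ l) = r ∷ linked-prefix (x' ∷ xs) l

entries : ∀ {n} → List (Fin n) → Subset n
entries []       = Subset.⊥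
entries (x ∷ xs) = ⁅ x ⁆ ∪ entries xs

entries-sound : ∀ {n} (xs : List (Fin n)) {x} → x ∈ entries xs → x List.∈ xs
entries-sound []       x∈ = ⊥-elim (∉⊥ x∈)
entries-sound (y ∷ ys) x∈ with x∈p∪q⁻ ⁅ y ⁆ (entries ys) x∈
... | inj₁ x∈y  = here (x∈⁅y⁆⇒x≡y y x∈y)
... | inj₂ x∈ys = there (entries-sound ys x∈ys)

entries-grow : ∀ {n} {x : Fin n} {xs} → ¬ x List.∈ xs → entries xs ⊂ entries (x ∷ xs)
entries-grow {x = x} {xs} x∉ =
  q⊆p∪q ⁅ x ⁆ (entries xs) , x , x∈p∪q⁺ (inj₁ (x∈⁅x⁆ x)) , λ x∈ → x∉ (entries-sound xs x∈)

module Tree {n} (D : Digraph n) (tree : EssentiallyTree D) where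

  no-loop : ∀ {a} → ¬ UAdj D a a
  no-loop {a} (inj₁ a→a) = proj₁ tree a a→a
  no-loop {a} (inj₂ a→a) = proj₁ tree a a→a

  -- A non-backtracking step b → c from the newest vertex b of a walk b ∷ a ∷ w
  -- (newest first) never revisits the walk: returning to c would close a cycle.
  fresh : ∀ {a b c} w → Unique (b ∷ a ∷ w) → Linked (UAdj D) (b ∷ a ∷ w)
        → UAdj D b c → c ≢ a → ¬ c List.∈ (b ∷ a ∷ w)
  fresh {a} {b} {c} w unique linked b~c c≢a c∈ with ∈-∃++ c∈
  ... | []           , _ , refl = no-loop b~c
  ... | _ ∷ []       , _ , refl = c≢a refl
  ... | _ ∷ _ ∷ path , _ , refl =
    let (uniquePath , ≢c) = unique-split (b ∷ a ∷ path) unique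
    in proj₂ (proj₂ tree) (c ∷ b ∷ a ∷ path)
         (s≤s (s≤s (s≤s z≤n)) , All.map ≢-sym ≢c ∷ uniquePath ,
          swap b~c ∷ linked-prefix (b ∷ a ∷ path) linked)

  -- A relation S inside the adjacency of the tree in which every step a → b can be
  -- continued by a step b → c with c ≠ a is empty: following it would give an endless
  -- non-backtracking walk, whose vertex set grows forever by `fresh`.
  no-endless-walk : (S : Fin n → Fin n → Set) → (∀ {a b} → S a b → UAdj D a b)
                  → (∀ {a b} → S a b → Σ (Fin n) λ c → S b c × c ≢ a) → ∀ {a b} → ¬ S a b
  no-endless-walk S adjacent continue {a} {b} s =
    walk [] (⊃-wellFounded _) s ((b≢a ∷ []) ∷ [] ∷ []) (swap (adjacent s) ∷ [-])
    where
    b≢a : b ≢ a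
    b≢a refl = no-loop (adjacent s)
    walk : ∀ {a b} w → Acc _⊃_ (entries (b ∷ a ∷ w)) → S a b
         → Unique (b ∷ a ∷ w) → Linked (UAdj D) (b ∷ a ∷ w) → ⊥
    walk {a} {b} w (acc larger) s unique linked =
      let (c , s' , c≢a) = continue s
          c∉ = fresh w unique linked (adjacent s') c≢a
      in walk (a ∷ w) (larger (entries-grow c∉)) s'
              (Allₚ.¬Any⇒All¬ _ c∉ ∷ unique) (swap (adjacent s') ∷ linked)

-- Δ(D) as an independence complex.  The ground set Fin (n * n) encodes ordered
-- pairs of vertices; two arcs conflict when they cannot lie in a common directed forest.
module Arcs {n} (D : Digraph n) where

  Pair : Set
  Pair = Fin n × Fin n

  code : Pair → Fin (n * n)
  code (i , j) = combine i j

  ends : Fin (n * n) → Pair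
  ends = remQuot n

  ends-code : ∀ p → ends (code p) ≡ p
  ends-code (i , j) = remQuot-combine i j

  code-ends : ∀ e → code (ends e) ≡ e
  code-ends = combine-remQuot {n} n

  data Conflicting : Pair → Pair → Set where
    same-head : ∀ {i i' j} → i ≢ i' → Conflicting (i , j) (i' , j)
    reversed  : ∀ {i j} → i ≢ j → Conflicting (i , j) (j , i)

  conflicting-sym : ∀ {p q} → Conflicting p q → Conflicting q p
  conflicting-sym (same-head i≢i') = same-head (≢-sym i≢i')
  conflicting-sym (reversed i≢j)   = reversed (≢-sym i≢j)

  conflicting-irr : ∀ {p} → ¬ Conflicting p p
  conflicting-irr (same-head i≢i) = i≢i refl
  conflicting-irr (reversed i≢i)  = i≢i refl

  conflicting? : ∀ p q → Dec (Conflicting p q)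
  conflicting? (i , j) (i' , j') with j ≟ j'
  ... | yes refl with i ≟ i'
  ...   | no  i≢i' = yes (same-head i≢i')
  ...   | yes refl = no conflicting-irr
  conflicting? (i , j) (i' , j') | no j≢j' with i ≟ j' | j ≟ i'
  ... | yes refl | yes refl = yes (reversed (≢-sym j≢j'))
  ... | no i≢j'  | _        = no λ { (same-head _) → j≢j' refl ; (reversed _) → i≢j' refl }
  ... | _        | no j≢i'  = no λ { (same-head _) → j≢j' refl ; (reversed _) → j≢i' refl }

  Conflict : Fin (n * n) → Fin (n * n) → Set
  Conflict e f = Conflicting (ends e) (ends f)

  conflict-code : ∀ {p q} → Conflicting p q → Conflict (code p) (code q)
  conflict-code {p} {q} = subst₂ Conflicting (sym (ends-code p)) (sym (ends-code q))

  open Independence Conflict (λ e f → conflicting? (ends e) (ends f)) conflicting-sym conflicting-irr public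

  ArcAt : Pair → Set
  ArcAt p = Arc D (proj₁ p) (proj₂ p)

  isArc? : ∀ e → Dec (ArcAt (ends e))
  isArc? e = adj D (proj₁ (ends e)) (proj₂ (ends e)) ≟ᵇ true

  arcs : Subset (n * n)
  arcs = subsetOf isArc?

  ∈arcs⁻ : ∀ {p} → code p ∈ arcs → ArcAt p
  ∈arcs⁻ {p} e∈ = subst ArcAt (ends-code p) (∈subsetOf⁻ isArc? e∈)

  forest-conflict-free : ∀ {F} → ΔD D F → ∀ p q → code p ∈ F → code q ∈ F → ¬ Conflicting p q
  forest-conflict-free (_ , indeg , _) (i , j) (i' , j) i→j i'→j (same-head i≢i') =
    i≢i' (indeg i i' j i→j i'→j)
  forest-conflict-free (_ , _ , acyclic) (i , j) (j , i) i→j j→i (reversed _) =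
    acyclic i (i→j ∷ [ j→i ])

  module _ (tree : EssentiallyTree D) where
    open Tree D tree

    -- Directed forests are exactly the conflict-free sets of arcs: a conflict-free set has
    -- in-degrees ≤ 1 and no directed 2-cycle, and a longer directed cycle in a tree would
    -- be an endless non-backtracking walk.  (This is where the tree hypothesis enters.)
    forests≅independent : SameFaces (ΔD D) (Ind arcs)
    forests≅independent = to , from
      where
      at : ∀ {F e} → e ∈ F → code (ends e) ∈ F
      at {F} {e} e∈F = subst (_∈ F) (sym (code-ends e)) e∈F
      to : ∀ F → ΔD D F → Ind arcs F
      to F forest@(arcsF , _ , _) =
        (λ {e} e∈F → ∈subsetOf⁺ isArc? (arcsF _ _ (at e∈F))) ,
        λ {e} {f} e∈F f∈F → forest-conflict-free forest (ends e) (ends f) (at e∈F) (at f∈F)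
      from : ∀ F → Ind arcs F → ΔD D F
      from F (F⊆arcs , indep) = arcsF , indeg , acyclic
        where
        arcsF : ∀ i j → InF F i j → Arc D i j
        arcsF i j i→j = ∈arcs⁻ (F⊆arcs i→j)
        indeg : ∀ i i' j → InF F i j → InF F i' j → i ≡ i'
        indeg i i' j i→j i'→j with i ≟ i'
        ... | yes i≡i' = i≡i'
        ... | no  i≢i' = ⊥-elim (indep i→j i'→j (conflict-code (same-head i≢i')))
        no-reversal : ∀ {a b} → InF F a b → InF F b a → ⊥
        no-reversal {a} {b} a→b b→a with a ≟ b
        ... | yes refl = proj₁ tree a (arcsF a a a→b)
        ... | no  a≢b  = indep a→b b→a (conflict-code (reversed a≢b))
        OnCycle : Fin n → Fin n → Set
        OnCycle a b = InF F a b × TransClosure (InF F) b a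
        continue : ∀ {a b} → OnCycle a b → Σ (Fin n) λ c → OnCycle b c × c ≢ a
        continue (a→b , [ b→a ]) = ⊥-elim (no-reversal a→b b→a)
        continue {a} {b} (a→b , _∷_ {y = c} b→c c→⁺a) =
          c , (b→c , c→⁺a ∷ʳ a→b) , λ c≡a → no-reversal a→b (subst (InF F b) c≡a b→c)
        acyclic : ∀ v → ¬ TransClosure (InF F) v v
        acyclic v [ v→v ]        = proj₁ tree v (arcsF v v v→v)
        acyclic v (v→c ∷ c→⁺v) =
          no-endless-walk OnCycle (λ (a→b , _) → inj₁ (arcsF _ _ a→b)) continue (v→c , c→⁺v)

    -- Otherwise every
    -- conflict can be escaped (`escape`), and two arcs a → b, k → b of A into the same
    -- vertex force an arc b → c of A together with another arc into c, where c ≠ a: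
    -- an endless non-backtracking walk in the tree.
    dominated-pair : ∀ A → A ⊆ arcs → HasEdge A
                   → Σ (Fin (n * n)) λ u → Σ (Fin (n * n)) λ v → Dominated A u v
    dominated-pair A A⊆arcs (x , y , x∈A , y∈A , x~y) with any? (λ u → any? (λ v → dominated? A u v))
    ... | yes found = found
    ... | no  none  = ⊥-elim (no-endless-walk Shared adjacent continue (proj₂ (proj₂ start)))
      where
      -- as no pair is dominated, for each conflict p ~ q some arc r of A conflicts with p
      -- but neither equals q nor conflicts with q
      escape : ∀ {p q} → code p ∈ A → code q ∈ A → Conflicting p q
             → Σ Pair λ r → code r ∈ A × Conflicting p r × r ≢ q × ¬ Conflicting q r
      escape {p} {q} p∈A q∈A p~q =
        let (w , ¬covers) = ¬∀⟶∃¬ (n * n) _ (covers? A (code p) (code q))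
                              (λ covers → none (code p , code q , p∈A , q∈A , conflict-code p~q , covers))
            (w∈A , p~w , w≢q , ¬q~w) = uncovered ¬covers
        in ends w , subst (_∈ A) (sym (code-ends w)) w∈A ,
           subst (λ p' → Conflicting p' (ends w)) (ends-code p) p~w ,
           (λ r≡q → w≢q (trans (sym (code-ends w)) (cong code r≡q))) ,
           (λ q~r → ¬q~w (subst (λ q' → Conflicting q' (ends w)) (sym (ends-code q)) q~r))

      Shared : Fin n → Fin n → Set
      Shared a b = code (a , b) ∈ A × Σ (Fin n) λ k → code (k , b) ∈ A × k ≢ a

      adjacent : ∀ {a b} → Shared a b → UAdj D a b
      adjacent (a→b , _) = inj₁ (∈arcs⁻ (A⊆arcs a→b))

      -- escaping the conflict of k → b with a → b cannot use an arc into b, so it uses the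
      -- reverse arc b → k; escaping the conflict of b → k with k → b needs another arc into k
      continue : ∀ {a b} → Shared a b → Σ (Fin n) λ c → Shared b c × c ≢ a
      continue {a} {b} (a→b , k , k→b , k≢a) with escape k→b a→b (same-head k≢a)
      ... | (i , b) , i→b , same-head k≢i , r≢a→b , ¬a~i with i ≟ a
      ...   | yes refl = ⊥-elim (r≢a→b refl)
      ...   | no  i≢a  = ⊥-elim (¬a~i (same-head (≢-sym i≢a)))
      continue {a} {b} (a→b , k , k→b , k≢a) | (b , k) , b→k , reversed k≢b , _ , _
        with escape b→k k→b (reversed (≢-sym k≢b))
      ... | (i , k) , i→k , same-head b≢i , _ , _ = k , (b→k , i , i→k , ≢-sym b≢i) , k≢a
      ... | (k , b) , _ , reversed _ , r≢k→b , _ = ⊥-elim (r≢k→b refl)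

      -- a conflict of A yields a first Shared step: directly for a common head, and for
      -- opposite arcs by escaping, which again must use an arc with a common head
      from-conflict : ∀ p q → code p ∈ A → code q ∈ A → Conflicting p q
                    → Σ (Fin n) λ a → Σ (Fin n) λ b → Shared a b
      from-conflict (i , j) (i' , j) p∈A q∈A (same-head i≢i') = i , j , p∈A , i' , q∈A , ≢-sym i≢i'
      from-conflict (i , j) (j , i) p∈A q∈A p~q@(reversed _) with escape p∈A q∈A p~q
      ... | (i' , j) , r∈A , same-head i≢i' , _ , _ = i , j , p∈A , i' , r∈A , ≢-sym i≢i'
      ... | (j , i) , _ , reversed _ , r≢q , _ = ⊥-elim (r≢q refl)

      start : Σ (Fin n) λ a → Σ (Fin n) λ b → Shared a b
      start = from-conflict (ends x) (ends y) (subst (_∈ A) (sym (code-ends x)) x∈A)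
                (subst (_∈ A) (sym (code-ends y)) y∈A) x~y

mainTheorem8 : ∀ (n : ℕ) (D : Digraph n) → EssentiallyTree D
             → VertexDecomposable (ΔD D) × Shellable (ΔD D)
mainTheorem8 n D tree = vd , vd⇒shellable sc vd
  where
  open Arcs D
  independent≅forests : SameFaces (Ind arcs) (ΔD D)
  independent≅forests = SameFaces-sym (forests≅independent tree)
  vd : VertexDecomposable (ΔD D)
  vd = vd-cong independent≅forests (dominance⇒vd arcs (dominated-pair tree) arcs ⊆-refl)
  sc : IsSimplicialComplex (ΔD D)
  sc = sc-cong independent≅forests (Ind-sc arcs)
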